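{- Let $g:\mathbb{Z}_{\ge0}\to\mathbb{C}$ be an arbitrary sequence and define formally, for $n\ge 1$, \[ f(n)=\sum_{k\ge0}\sum_{l=0}^{2^{k}-1}g\left(2^{k}n+l\right). \] Then, as identities of formal sums, $g(n)=f(n)-f(2n)-f(2n+1)$ for every $n\ge1$, and \[ \sum_{n\ge1}s_{2}(n)g(n)=\sum_{n\ge0}f(2n+1)=\sum_{n,k\ge0}\sum_{l=0}^{2^{k}-1}g\left(2^{k+1}n+2^{k}+l\right). \]
   Context: $s_2(n)$ is the number of ones in the binary expansion of $n$. "Identity of formal sums" means: when both sides are expanded as (possibly infinite) formal linear combinations of the symbols $g(m)$, $m\ge0$, each symbol $g(m)$ occurs with the same (finite) coefficient on both sides. -}

module Defs where

open import Data.Nat using (ℕ; zero; suc; _+_; _*_; _^_; _<_; _≤_; _<?_; _≤?_; _≟_; _%_; _/_)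
open import Data.Integer as ℤ using (ℤ; +_)
open import Relation.Nullary.Decidable using (Dec; yes; no)

[_] : {P : Set} → Dec P → ℕ
[ yes _ ] = 1
[ no  _ ] = 0

Σ≤ : ℕ → (ℕ → ℕ) → ℕ
Σ≤ zero    h = h 0
Σ≤ (suc N) h = Σ≤ N h + h (suc N)

-- binary digit sum s₂(n): number of ones in the binary expansion of n
-- (fuel-based; fuel n suffices since n halves each step)
s₂-aux : ℕ → ℕ → ℕ
s₂-aux zero    n = 0
s₂-aux (suc f) n = n % 2 + s₂-aux f (n / 2)

s₂ : ℕ → ℕ
s₂ n = s₂-aux n n

-- A formal linear combination of the symbols g(m) is represented by its
-- coefficient function  m ↦ (coefficient of g(m)).
-- For an index family of the form  Σ_{indices} g(index-expr), the coefficient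
-- of g(m) is the number of index tuples whose index-expr equals m.  Every
-- index variable below is bounded by m on any solution (k < 2^k ≤ 2^k n + l,
-- l ≤ 2^k n + l, n ≤ ...), so counting over the box [0,m] counts all solutions.

-- coefficient of g(m) in  f(n) = Σ_{k≥0} Σ_{l=0}^{2^k-1} g(2^k n + l)
coeff-f : ℕ → ℕ → ℕ
coeff-f n m = Σ≤ m λ k → Σ≤ m λ l →
  [ l <? 2 ^ k ] * [ 2 ^ k * n + l ≟ m ]

coeff-g : ℕ → ℕ → ℕ
coeff-g n m = [ n ≟ m ]

-- coefficient of g(m) in  Σ_{n≥1} s₂(n) g(n)
coeff-LHS : ℕ → ℕ
coeff-LHS m = Σ≤ m λ n → [ 1 ≤? n ] * s₂ n * [ n ≟ m ]

-- coefficient of g(m) in  Σ_{n≥0} f(2n+1)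
coeff-MID : ℕ → ℕ
coeff-MID m = Σ≤ m λ n → coeff-f (2 * n + 1) m

-- coefficient of g(m) in  Σ_{n,k≥0} Σ_{l=0}^{2^k-1} g(2^{k+1} n + 2^k + l)
coeff-RHS : ℕ → ℕ
coeff-RHS m = Σ≤ m λ n → Σ≤ m λ k → Σ≤ m λ l →
  [ l <? 2 ^ k ] * [ 2 ^ (k + 1) * n + 2 ^ k + l ≟ m ]

module Submission where

-- The proof rests on
-- one observation: the coefficient of g(m) in the block
-- Σ_{l<2^k} g(2^k x + l) is the indicator of m lying in the dyadic interval
-- [2^k x, 2^k x + 2^k).  Hence the coefficient of g(m) in f(x) is the number
-- of levels k whose dyadic interval of index x contains m, i.e. the number of
-- ways to obtain x from m by deleting trailing binary digits.
--
-- Two facts about dyadic intervals drive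
-- everything: the interval of level k+1 and index x is the disjoint union of
-- those of level k and indices 2x, 2x+1 (giving g(n) = f(n) - f(2n) - f(2n+1)
-- after telescoping), and m lies in it iff ⌊m/2⌋ lies in the interval of level
-- k (giving the recursion G(m) = m mod 2 + G(⌊m/2⌋) for the coefficient G(m)
-- of Σ_n f(2n+1), which is also the recursion of s₂).  The last identity is a
-- pointwise rewriting 2^k (2n+1) + l = 2^{k+1} n + 2^k + l.

open import Defs
open import Data.Nat using (ℕ; _≤_; _+_; _*_)
open import Data.Integer using (+_) renaming (_-_ to _⊖ℤ_)
open import Data.Product using (_×_)
open import Relation.Binary.PropositionalEquality using (_≡_)

open import Data.Nat using (zero; suc; _<_; _^_; _∸_; _%_; _/_; _<?_; _≤?_; _≟_; z≤n; s≤s)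
open import Data.Nat.Properties
open import Data.Nat.DivMod
  using (m≡m%n+[m/n]*n; m%n<n; m/n<m; [m+kn]%n≡m%n; m*n%n≡0; m*n/n≡m; m/n*n≤m; /-monoˡ-≤)
open import Data.Nat.Induction using (<-rec)
import Data.Nat.Tactic.RingSolver as ℕ-Solver
import Data.Integer as ℤ
import Data.Integer.Properties as ℤP
import Data.Integer.Tactic.RingSolver as ℤ-Solver
open import Data.Product using (_,_; proj₁; proj₂)
open import Data.Sum using (inj₁; inj₂)
open import Data.Empty using (⊥-elim)
open import Function using (_∘_)
open import Relation.Nullary using (¬_; Dec; yes; no)
open import Relation.Binary.PropositionalEquality using (refl; sym; trans; cong; cong₂; subst; _≢_; module ≡-Reasoning)
open ≡-Reasoning

iverson-true : ∀ {P : Set} (d : Dec P) → P → [ d ] ≡ 1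
iverson-true (yes _) _ = refl
iverson-true (no ¬p) p = ⊥-elim (¬p p)

iverson-false : ∀ {P : Set} (d : Dec P) → ¬ P → [ d ] ≡ 0
iverson-false (yes p) ¬p = ⊥-elim (¬p p)
iverson-false (no _)  _  = refl

iverson-cong : ∀ {P Q : Set} (d : Dec P) (e : Dec Q) → (P → Q) → (Q → P) → [ d ] ≡ [ e ]
iverson-cong (yes _) (yes _) _ _ = refl
iverson-cong (yes p) (no ¬q) f _ = ⊥-elim (¬q (f p))
iverson-cong (no ¬p) (yes q) _ g = ⊥-elim (¬p (g q))
iverson-cong (no _)  (no _)  _ _ = refl

iverson-product : ∀ {P Q R : Set} (p : Dec P) (q : Dec Q) (r : Dec R) →
                  (P → Q → R) → (R → P × Q) → [ p ] * [ q ] ≡ [ r ]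
iverson-product (yes p) (yes q) r to _    = sym (iverson-true r (to p q))
iverson-product (yes p) (no ¬q) r _  from = sym (iverson-false r (¬q ∘ proj₂ ∘ from))
iverson-product (no ¬p) q       r _  from = sym (iverson-false r (¬p ∘ proj₁ ∘ from))

Σ≤-cong : ∀ N {h h′ : ℕ → ℕ} → (∀ i → h i ≡ h′ i) → Σ≤ N h ≡ Σ≤ N h′
Σ≤-cong zero    eq = eq 0
Σ≤-cong (suc N) eq = cong₂ _+_ (Σ≤-cong N eq) (eq (suc N))

Σ≤-vanish : ∀ N {h : ℕ → ℕ} → (∀ i → h i ≡ 0) → Σ≤ N h ≡ 0
Σ≤-vanish zero    eq = eq 0
Σ≤-vanish (suc N) eq = cong₂ _+_ (Σ≤-vanish N eq) (eq (suc N))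

Σ≤-+ : ∀ N (h h′ : ℕ → ℕ) → Σ≤ N (λ i → h i + h′ i) ≡ Σ≤ N h + Σ≤ N h′
Σ≤-+ zero    h h′ = refl
Σ≤-+ (suc N) h h′ = begin
  Σ≤ N (λ i → h i + h′ i) + (h (suc N) + h′ (suc N))
    ≡⟨ cong (_+ (h (suc N) + h′ (suc N))) (Σ≤-+ N h h′) ⟩
  Σ≤ N h + Σ≤ N h′ + (h (suc N) + h′ (suc N))
    ≡⟨ interchange (Σ≤ N h) (Σ≤ N h′) (h (suc N)) (h′ (suc N)) ⟩
  Σ≤ N h + h (suc N) + (Σ≤ N h′ + h′ (suc N)) ∎
  where
  interchange : ∀ a b c d → a + b + (c + d) ≡ a + c + (b + d)
  interchange = ℕ-Solver.solve-∀

Σ≤-peel : ∀ N (h : ℕ → ℕ) → Σ≤ (suc N) h ≡ h 0 + Σ≤ N (h ∘ suc)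
Σ≤-peel zero    h = refl
Σ≤-peel (suc N) h = trans (cong (_+ h (suc (suc N))) (Σ≤-peel N h)) (+-assoc (h 0) _ _)

Σ≤-select : ∀ N j (h : ℕ → ℕ) → Σ≤ N (λ i → h i * [ i ≟ j ]) ≡ [ j ≤? N ] * h j
Σ≤-select zero zero    h = trans (*-identityʳ (h 0)) (sym (+-identityʳ (h 0)))
Σ≤-select zero (suc j) h = *-zeroʳ (h 0)
Σ≤-select (suc N) j h with suc N ≟ j
... | yes refl = begin
  Σ≤ N (λ i → h i * [ i ≟ suc N ]) + h (suc N) * 1
    ≡⟨ cong₂ _+_ (Σ≤-select N (suc N) h) (*-identityʳ (h (suc N))) ⟩
  [ suc N ≤? N ] * h (suc N) + h (suc N)
    ≡⟨ cong (λ t → t * h (suc N) + h (suc N)) (iverson-false (suc N ≤? N) (<⇒≱ ≤-refl)) ⟩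
  h (suc N)
    ≡⟨ sym (trans (cong (_* h (suc N)) (iverson-true (suc N ≤? suc N) ≤-refl)) (*-identityˡ _)) ⟩
  [ suc N ≤? suc N ] * h (suc N) ∎
... | no N+1≢j = begin
  Σ≤ N (λ i → h i * [ i ≟ j ]) + h (suc N) * 0
    ≡⟨ cong₂ _+_ (Σ≤-select N j h) (*-zeroʳ (h (suc N))) ⟩
  [ j ≤? N ] * h j + 0
    ≡⟨ +-identityʳ _ ⟩
  [ j ≤? N ] * h j
    ≡⟨ cong (_* h j) (iverson-cong (j ≤? N) (j ≤? suc N) m≤n⇒m≤1+n
         (λ j≤N+1 → m<1+n⇒m≤n (≤∧≢⇒< j≤N+1 (N+1≢j ∘ sym)))) ⟩
  [ j ≤? suc N ] * h j ∎

Σ≤-truncate : ∀ {M N} (h : ℕ → ℕ) → M ≤ N → (∀ j → M < j → h j ≡ 0) → Σ≤ N h ≡ Σ≤ M h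
Σ≤-truncate {N = zero}  h z≤n  _ = refl
Σ≤-truncate {M} {suc N} h M≤N+1 vanish with m≤n⇒m<n∨m≡n M≤N+1
... | inj₁ M<N+1 = begin
  Σ≤ N h + h (suc N)   ≡⟨ cong₂ _+_ (Σ≤-truncate h (m<1+n⇒m≤n M<N+1) vanish) (vanish (suc N) M<N+1) ⟩
  Σ≤ M h + 0           ≡⟨ +-identityʳ _ ⟩
  Σ≤ M h               ∎
... | inj₂ refl = refl

Σ≤-stable : ∀ {K} (h : ℕ → ℕ) → (∀ j → K ≤ j → h j ≡ 0) →
            ∀ M N → K ≤ suc M → K ≤ suc N → Σ≤ M h ≡ Σ≤ N h
Σ≤-stable {K} h vanish M N K≤M+1 K≤N+1 with ≤-total M N
... | inj₁ M≤N = sym (Σ≤-truncate h M≤N (λ j M<j → vanish j (≤-trans K≤M+1 M<j)))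
... | inj₂ N≤M = Σ≤-truncate h N≤M (λ j N<j → vanish j (≤-trans K≤N+1 N<j))

interval : ℕ → ℕ → ℕ → ℕ
interval A B m = [ A ≤? m ] * [ m <? A + B ]

block-coefficient : ∀ A B m → Σ≤ m (λ l → [ l <? B ] * [ A + l ≟ m ]) ≡ interval A B m
block-coefficient A B m with A ≤? m
... | no A≰m = Σ≤-vanish m λ l → begin
  [ l <? B ] * [ A + l ≟ m ]  ≡⟨ cong ([ l <? B ] *_) (iverson-false (A + l ≟ m) (A≰m ∘ A≤m)) ⟩
  [ l <? B ] * 0              ≡⟨ *-zeroʳ [ l <? B ] ⟩
  0                           ∎
  where
  A≤m : ∀ {l} → A + l ≡ m → A ≤ m
  A≤m refl = m≤m+n A _
... | yes A≤m = begin
  Σ≤ m (λ l → [ l <? B ] * [ A + l ≟ m ])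
    ≡⟨ Σ≤-cong m (λ l → cong ([ l <? B ] *_)
         (iverson-cong (A + l ≟ m) (l ≟ m ∸ A) (λ { refl → sym (m+n∸m≡n A l) })
                       (λ { refl → m+[n∸m]≡n A≤m }))) ⟩
  Σ≤ m (λ l → [ l <? B ] * [ l ≟ m ∸ A ])
    ≡⟨ Σ≤-select m (m ∸ A) (λ l → [ l <? B ]) ⟩
  [ m ∸ A ≤? m ] * [ m ∸ A <? B ]
    ≡⟨ cong₂ _*_ (iverson-true (m ∸ A ≤? m) (m∸n≤m m A))
                 (iverson-cong (m ∸ A <? B) (m <? A + B) shift unshift) ⟩
  1 * [ m <? A + B ] ∎
  where
  shift : m ∸ A < B → m < A + B
  shift p = subst (_< A + B) (m+[n∸m]≡n A≤m) (+-monoʳ-< A p)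
  unshift : m < A + B → m ∸ A < B
  unshift p = +-cancelˡ-< A (m ∸ A) B (≤-trans (s≤s (≤-reflexive (m+[n∸m]≡n A≤m))) p)

interval-split : ∀ A B C m → interval A (B + C) m ≡ interval A B m + interval (A + B) C m
interval-split A B C m with A ≤? m | A + B ≤? m
... | no _    | no _     = refl
... | no A≰m  | yes A+B≤m = ⊥-elim (A≰m (≤-trans (m≤m+n A B) A+B≤m))
... | yes _   | yes A+B≤m
  rewrite iverson-false (m <? A + B) (≤⇒≯ A+B≤m) | +-assoc A B C = refl
... | yes _   | no A+B≰m
  rewrite iverson-true (m <? A + B) (≰⇒> A+B≰m)
        | iverson-true (m <? A + (B + C))
            (<-≤-trans (≰⇒> A+B≰m) (≤-trans (m≤m+n (A + B) C) (≤-reflexive (+-assoc A B C))))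
  = refl

interval-point : ∀ A m → interval A 1 m ≡ [ A ≟ m ]
interval-point A m = iverson-product (A ≤? m) (m <? A + 1) (A ≟ m)
  (λ A≤m m<A+1 → ≤-antisym A≤m (m<1+n⇒m≤n (subst (m <_) (+-comm A 1) m<A+1)))
  (λ { refl → ≤-refl , subst (A <_) (+-comm 1 A) ≤-refl })

≤-half : ∀ C m → 2 * C ≤ m → C ≤ m / 2
≤-half C m 2C≤m = subst (_≤ m / 2) (m*n/n≡m C 2) (/-monoˡ-≤ 2 (subst (_≤ m) (*-comm 2 C) 2C≤m))

half-≤ : ∀ C m → C ≤ m / 2 → 2 * C ≤ m
half-≤ C m C≤m/2 = ≤-trans (subst (2 * C ≤_) (*-comm 2 (m / 2)) (*-monoʳ-≤ 2 C≤m/2)) (m/n*n≤m m 2)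

double-≤-half : ∀ C m → [ 2 * C ≤? m ] ≡ [ C ≤? m / 2 ]
double-≤-half C m = iverson-cong _ _ (≤-half C m) (half-≤ C m)

double->-half : ∀ C m → [ m <? 2 * C ] ≡ [ m / 2 <? C ]
double->-half C m = iverson-cong _ _ (λ m<2C → ≰⇒> (<⇒≱ m<2C ∘ half-≤ C m))
                                     (λ m/2<C → ≰⇒> (<⇒≱ m/2<C ∘ ≤-half C m))

n<2^n : ∀ n → n < 2 ^ n
n<2^n zero    = s≤s z≤n
n<2^n (suc n) = +-mono-≤ (m^n>0 2 n) (≤-trans (n<2^n n) (m≤m+n (2 ^ n) 0))

≤-*-positive : ∀ a x → 1 ≤ x → a ≤ a * x
≤-*-positive a x 1≤x = subst (_≤ a * x) (*-identityʳ a) (*-monoʳ-≤ a 1≤x)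

dyadic : ℕ → ℕ → ℕ → ℕ
dyadic k x m = interval (2 ^ k * x) (2 ^ k) m

dyadic-zero : ∀ x m → dyadic 0 x m ≡ [ x ≟ m ]
dyadic-zero x m = trans (cong (λ A → interval A 1 m) (*-identityˡ x)) (interval-point x m)

dyadic-split : ∀ k x m → dyadic (suc k) x m ≡ dyadic k (2 * x) m + dyadic k (2 * x + 1) m
dyadic-split k x m = begin
  interval (2 * 2 ^ k * x) (2 * 2 ^ k) m
    ≡⟨ cong₂ (λ A B → interval A B m) (reassociate (2 ^ k) x) (double (2 ^ k)) ⟩
  interval (2 ^ k * (2 * x)) (2 ^ k + 2 ^ k) m
    ≡⟨ interval-split (2 ^ k * (2 * x)) (2 ^ k) (2 ^ k) m ⟩
  dyadic k (2 * x) m + interval (2 ^ k * (2 * x) + 2 ^ k) (2 ^ k) m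
    ≡⟨ cong (λ A → dyadic k (2 * x) m + interval A (2 ^ k) m) (next-index (2 ^ k) x) ⟩
  dyadic k (2 * x) m + dyadic k (2 * x + 1) m ∎
  where
  reassociate : ∀ a x → 2 * a * x ≡ a * (2 * x)
  reassociate = ℕ-Solver.solve-∀
  double : ∀ a → 2 * a ≡ a + a
  double = ℕ-Solver.solve-∀
  next-index : ∀ a x → a * (2 * x) + a ≡ a * (2 * x + 1)
  next-index = ℕ-Solver.solve-∀

dyadic-halve : ∀ k x m → dyadic (suc k) x m ≡ dyadic k x (m / 2)
dyadic-halve k x m
  rewrite *-assoc 2 (2 ^ k) x | sym (*-distribˡ-+ 2 (2 ^ k * x) (2 ^ k))
  = cong₂ _*_ (double-≤-half (2 ^ k * x) m) (double->-half (2 ^ k * x + 2 ^ k) m)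

dyadic-below : ∀ k x m → m < 2 ^ k * x → dyadic k x m ≡ 0
dyadic-below k x m m<A = cong (_* [ m <? 2 ^ k * x + 2 ^ k ]) (iverson-false (2 ^ k * x ≤? m) (<⇒≱ m<A))

dyadic-high : ∀ k x m → 1 ≤ x → m ≤ k → dyadic k x m ≡ 0
dyadic-high k x m 1≤x m≤k =
  dyadic-below k x m (≤-trans (s≤s m≤k) (≤-trans (n<2^n k) (≤-*-positive (2 ^ k) x 1≤x)))

dyadicCount : ℕ → ℕ → ℕ
dyadicCount x m = Σ≤ m (λ k → dyadic k x m)

coeff-f≡dyadicCount : ∀ x m → coeff-f x m ≡ dyadicCount x m
coeff-f≡dyadicCount x m = Σ≤-cong m (λ k → block-coefficient (2 ^ k * x) (2 ^ k) m)

dyadicCount-bound : ∀ N x m → 1 ≤ x → m ≤ suc N → Σ≤ N (λ k → dyadic k x m) ≡ dyadicCount x m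
dyadicCount-bound N x m 1≤x m≤N+1 =
  Σ≤-stable (λ k → dyadic k x m) (λ k m≤k → dyadic-high k x m 1≤x m≤k) N m m≤N+1 (n≤1+n m)

-- Coefficientwise f(n) = g(n) + (f(2n) + f(2n+1)): level 0 contributes g(n),
-- and each level k+1 of n refines into level k of 2n and of 2n+1.
dyadicCount-recursion : ∀ n → 1 ≤ n → ∀ m →
  dyadicCount n m ≡ [ n ≟ m ] + (dyadicCount (2 * n) m + dyadicCount (2 * n + 1) m)
dyadicCount-recursion (suc _) _   zero    = refl
dyadicCount-recursion n       1≤n (suc M) = begin
  dyadicCount n m
    ≡⟨ Σ≤-peel M (λ k → dyadic k n m) ⟩
  dyadic 0 n m + Σ≤ M (λ k → dyadic (suc k) n m)
    ≡⟨ cong₂ _+_ (dyadic-zero n m) (Σ≤-cong M (λ k → dyadic-split k n m)) ⟩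
  [ n ≟ m ] + Σ≤ M (λ k → dyadic k (2 * n) m + dyadic k (2 * n + 1) m)
    ≡⟨ cong (_+_ [ n ≟ m ]) (Σ≤-+ M (λ k → dyadic k (2 * n) m) (λ k → dyadic k (2 * n + 1) m)) ⟩
  [ n ≟ m ] + (Σ≤ M (λ k → dyadic k (2 * n) m) + Σ≤ M (λ k → dyadic k (2 * n + 1) m))
    ≡⟨ cong (_+_ [ n ≟ m ]) (cong₂ _+_ (dyadicCount-bound M (2 * n) m 1≤2n ≤-refl)
                                      (dyadicCount-bound M (2 * n + 1) m 1≤2n+1 ≤-refl)) ⟩
  [ n ≟ m ] + (dyadicCount (2 * n) m + dyadicCount (2 * n + 1) m) ∎
  where
  m = suc M
  1≤2n : 1 ≤ 2 * n
  1≤2n = ≤-trans 1≤n (m≤m+n n (n + 0))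
  1≤2n+1 : 1 ≤ 2 * n + 1
  1≤2n+1 = m≤n+m 1 (2 * n)

subtract-summands : ∀ a b c → + a ≡ ((+ (a + (b + c))) ⊖ℤ (+ b)) ⊖ℤ (+ c)
subtract-summands a b c = begin
  + a
    ≡⟨ cancel (+ a) (+ b) (+ c) ⟩
  ((+ a ℤ.+ (+ b ℤ.+ + c)) ⊖ℤ + b) ⊖ℤ + c
    ≡⟨ cong (λ t → (t ⊖ℤ + b) ⊖ℤ + c) (sym (trans (ℤP.pos-+ a (b + c)) (cong (ℤ._+_ (+ a)) (ℤP.pos-+ b c)))) ⟩
  ((+ (a + (b + c))) ⊖ℤ (+ b)) ⊖ℤ (+ c) ∎
  where
  cancel : ∀ a b c → a ≡ ((a ℤ.+ (b ℤ.+ c)) ⊖ℤ b) ⊖ℤ c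
  cancel = ℤ-Solver.solve-∀

half< : ∀ M → suc M / 2 < suc M
half< M = m/n<m (suc M) 2 (s≤s (s≤s z≤n))

half-≤-pred : ∀ x f → x ≤ suc f → x / 2 ≤ f
half-≤-pred zero    f _       = z≤n
half-≤-pred (suc y) f y<suc-f = m<1+n⇒m≤n (<-≤-trans (half< y) y<suc-f)

s₂-aux-zero : ∀ f → s₂-aux f 0 ≡ 0
s₂-aux-zero zero    = refl
s₂-aux-zero (suc f) = s₂-aux-zero f

s₂-aux-fuel : ∀ f f′ x → x ≤ f → x ≤ f′ → s₂-aux f x ≡ s₂-aux f′ x
s₂-aux-fuel zero    f′       zero    _ _ = sym (s₂-aux-zero f′)
s₂-aux-fuel (suc f) zero     zero    _ _ = s₂-aux-zero (suc f)
s₂-aux-fuel (suc f) (suc f′) x x≤f+1 x≤f′+1 =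
  cong (_+_ (x % 2)) (s₂-aux-fuel f f′ (x / 2) (half-≤-pred x f x≤f+1) (half-≤-pred x f′ x≤f′+1))

s₂-recursion : ∀ M → s₂ (suc M) ≡ suc M % 2 + s₂ (suc M / 2)
s₂-recursion M = cong (_+_ (suc M % 2))
  (s₂-aux-fuel M (suc M / 2) (suc M / 2) (half-≤-pred (suc M) M ≤-refl) ≤-refl)

s₂-unique : (h : ℕ → ℕ) → h 0 ≡ 0 → (∀ M → h (suc M) ≡ suc M % 2 + h (suc M / 2)) →
            ∀ m → h m ≡ s₂ m
s₂-unique h h0 h-recursion = <-rec (λ m → h m ≡ s₂ m) step
  where
  step : ∀ m → (∀ {k} → k < m → h k ≡ s₂ k) → h m ≡ s₂ m
  step zero    _  = h0
  step (suc M) ih = begin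
    h (suc M)                    ≡⟨ h-recursion M ⟩
    suc M % 2 + h (suc M / 2)    ≡⟨ cong (_+_ (suc M % 2)) (ih (half< M)) ⟩
    suc M % 2 + s₂ (suc M / 2)   ≡⟨ sym (s₂-recursion M) ⟩
    s₂ (suc M)                   ∎

odd-form : ∀ n → 2 * n + 1 ≡ 1 + n * 2
odd-form = ℕ-Solver.solve-∀

odd≢even : ∀ n q → 2 * n + 1 ≢ q * 2
odd≢even n q eq = 1≢0 (begin
  1                 ≡⟨ sym ([m+kn]%n≡m%n 1 n 2) ⟩
  (1 + n * 2) % 2   ≡⟨ cong (_% 2) (trans (sym (odd-form n)) eq) ⟩
  (q * 2) % 2       ≡⟨ m*n%n≡0 q 2 ⟩
  0                 ∎)
  where
  1≢0 : 1 ≢ 0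
  1≢0 ()

odd-count : ∀ m → Σ≤ m (λ n → [ 2 * n + 1 ≟ m ]) ≡ m % 2
odd-count m = begin
  Σ≤ m (λ n → [ 2 * n + 1 ≟ m ])
    ≡⟨ cong (λ t → Σ≤ t (λ n → [ 2 * n + 1 ≟ t ])) (m≡m%n+[m/n]*n m 2) ⟩
  Σ≤ (m % 2 + m / 2 * 2) (λ n → [ 2 * n + 1 ≟ m % 2 + m / 2 * 2 ])
    ≡⟨ count-by-digit (m % 2) (m / 2) (m%n<n m 2) ⟩
  m % 2 ∎
  where
  count-by-digit : ∀ r q → r < 2 → Σ≤ (r + q * 2) (λ n → [ 2 * n + 1 ≟ r + q * 2 ]) ≡ r
  count-by-digit zero q _ = Σ≤-vanish (q * 2) (λ n → iverson-false _ (odd≢even n q))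
  count-by-digit (suc zero) q _ = begin
    Σ≤ (1 + q * 2) (λ n → [ 2 * n + 1 ≟ 1 + q * 2 ])
      ≡⟨ Σ≤-cong (1 + q * 2) (λ n → trans
           (iverson-cong _ (n ≟ q) (λ eq → *-cancelʳ-≡ n q 2 (suc-injective (trans (sym (odd-form n)) eq)))
                                   (λ { refl → odd-form n }))
           (sym (*-identityˡ _))) ⟩
    Σ≤ (1 + q * 2) (λ n → 1 * [ n ≟ q ])
      ≡⟨ Σ≤-select (1 + q * 2) q (λ _ → 1) ⟩
    [ q ≤? 1 + q * 2 ] * 1
      ≡⟨ cong (_* 1) (iverson-true (q ≤? 1 + q * 2) (≤-trans (m≤m*n q 2) (m≤n+m (q * 2) 1))) ⟩
    1 ∎
  count-by-digit (suc (suc r)) q (s≤s (s≤s ()))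

oddDyadicCount : ℕ → ℕ
oddDyadicCount m = Σ≤ m (λ n → dyadicCount (2 * n + 1) m)

-- Level 0 of the odd indices detects the last binary digit of m, and the
-- higher levels reproduce the whole count for ⌊m/2⌋.
oddDyadicCount-recursion : ∀ M → oddDyadicCount (suc M) ≡ suc M % 2 + oddDyadicCount (suc M / 2)
oddDyadicCount-recursion M = begin
  Σ≤ m (λ n → dyadicCount (odd n) m)
    ≡⟨ Σ≤-cong m (λ n → Σ≤-peel M (λ k → dyadic k (odd n) m)) ⟩
  Σ≤ m (λ n → dyadic 0 (odd n) m + Σ≤ M (λ k → dyadic (suc k) (odd n) m))
    ≡⟨ Σ≤-+ m (λ n → dyadic 0 (odd n) m) (λ n → Σ≤ M (λ k → dyadic (suc k) (odd n) m)) ⟩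
  Σ≤ m (λ n → dyadic 0 (odd n) m) + Σ≤ m (λ n → Σ≤ M (λ k → dyadic (suc k) (odd n) m))
    ≡⟨ cong₂ _+_ (trans (Σ≤-cong m (λ n → dyadic-zero (odd n) m)) (odd-count m))
                 (Σ≤-cong m (λ n → Σ≤-cong M (λ k → dyadic-halve k (odd n) m))) ⟩
  m % 2 + Σ≤ m (λ n → Σ≤ M (λ k → dyadic k (odd n) q))
    ≡⟨ cong (_+_ (m % 2)) (Σ≤-cong m (λ n → dyadicCount-bound M (odd n) q (m≤n+m 1 (2 * n)) (<⇒≤ (half< M)))) ⟩
  m % 2 + Σ≤ m (λ n → dyadicCount (odd n) q)
    ≡⟨ cong (_+_ (m % 2)) (Σ≤-truncate (λ n → dyadicCount (odd n) q) (<⇒≤ (half< M))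
         (λ n q<n → Σ≤-vanish q (λ k → dyadic-below k (odd n) q (<-≤-trans q<n (index-below k n))))) ⟩
  m % 2 + oddDyadicCount q ∎
  where
  m = suc M
  q = m / 2
  odd : ℕ → ℕ
  odd n = 2 * n + 1
  index-below : ∀ k n → n ≤ 2 ^ k * odd n
  index-below k n = ≤-trans (≤-trans (m≤m+n n (n + 0)) (m≤m+n (2 * n) 1))
    (subst (odd n ≤_) (*-comm (odd n) (2 ^ k)) (≤-*-positive (odd n) (2 ^ k) (m^n>0 2 k)))

g≡f-recursion : ∀ n → 1 ≤ n → ∀ m →
  + coeff-g n m ≡ ((+ coeff-f n m) ⊖ℤ (+ coeff-f (2 * n) m)) ⊖ℤ (+ coeff-f (2 * n + 1) m)
g≡f-recursion n 1≤n m = begin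
  + [ n ≟ m ]
    ≡⟨ subtract-summands [ n ≟ m ] (dyadicCount (2 * n) m) (dyadicCount (2 * n + 1) m) ⟩
  ((+ ([ n ≟ m ] + (dyadicCount (2 * n) m + dyadicCount (2 * n + 1) m)))
     ⊖ℤ (+ dyadicCount (2 * n) m)) ⊖ℤ (+ dyadicCount (2 * n + 1) m)
    ≡⟨ cong (λ a → ((+ a) ⊖ℤ (+ dyadicCount (2 * n) m)) ⊖ℤ (+ dyadicCount (2 * n + 1) m))
            (sym (dyadicCount-recursion n 1≤n m)) ⟩
  ((+ dyadicCount n m) ⊖ℤ (+ dyadicCount (2 * n) m)) ⊖ℤ (+ dyadicCount (2 * n + 1) m)
    ≡⟨ sym (cong₂ (λ a b → ((+ a) ⊖ℤ (+ b)) ⊖ℤ (+ dyadicCount (2 * n + 1) m))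
                  (coeff-f≡dyadicCount n m) (coeff-f≡dyadicCount (2 * n) m)) ⟩
  ((+ coeff-f n m) ⊖ℤ (+ coeff-f (2 * n) m)) ⊖ℤ (+ dyadicCount (2 * n + 1) m)
    ≡⟨ sym (cong (λ c → ((+ coeff-f n m) ⊖ℤ (+ coeff-f (2 * n) m)) ⊖ℤ (+ c))
                 (coeff-f≡dyadicCount (2 * n + 1) m)) ⟩
  ((+ coeff-f n m) ⊖ℤ (+ coeff-f (2 * n) m)) ⊖ℤ (+ coeff-f (2 * n + 1) m) ∎

coeff-LHS≡s₂ : ∀ m → coeff-LHS m ≡ s₂ m
coeff-LHS≡s₂ m = begin
  coeff-LHS m                          ≡⟨ Σ≤-select m m (λ n → [ 1 ≤? n ] * s₂ n) ⟩
  [ m ≤? m ] * ([ 1 ≤? m ] * s₂ m)     ≡⟨ cong (_* ([ 1 ≤? m ] * s₂ m)) (iverson-true (m ≤? m) ≤-refl) ⟩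
  1 * ([ 1 ≤? m ] * s₂ m)              ≡⟨ *-identityˡ _ ⟩
  [ 1 ≤? m ] * s₂ m                    ≡⟨ positive-only m ⟩
  s₂ m                                 ∎
  where
  positive-only : ∀ m → [ 1 ≤? m ] * s₂ m ≡ s₂ m
  positive-only zero    = refl
  positive-only (suc m) = *-identityˡ (s₂ (suc m))

coeff-MID≡s₂ : ∀ m → coeff-MID m ≡ s₂ m
coeff-MID≡s₂ m = trans (Σ≤-cong m (λ n → coeff-f≡dyadicCount (2 * n + 1) m))
                       (s₂-unique oddDyadicCount refl oddDyadicCount-recursion m)

coeff-MID≡coeff-RHS : ∀ m → coeff-MID m ≡ coeff-RHS m
coeff-MID≡coeff-RHS m = Σ≤-cong m λ n → Σ≤-cong m λ k → Σ≤-cong m λ l →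
  cong (λ t → [ l <? 2 ^ k ] * [ t ≟ m ])
    (trans (expand (2 ^ k) n l) (cong (λ a → a * n + 2 ^ k + l) (sym (^-distribˡ-+-* 2 k 1))))
  where
  expand : ∀ a n l → a * (2 * n + 1) + l ≡ a * 2 * n + a + l
  expand = ℕ-Solver.solve-∀

theorem22 : ((n : ℕ) → 1 ≤ n → (m : ℕ) →
    + coeff-g n m ≡ ((+ coeff-f n m) ⊖ℤ (+ coeff-f (2 * n) m)) ⊖ℤ (+ coeff-f (2 * n + 1) m))
    × ((m : ℕ) → coeff-LHS m ≡ coeff-MID m)
    × ((m : ℕ) → coeff-MID m ≡ coeff-RHS m)
theorem22 = g≡f-recursion
          , (λ m → trans (coeff-LHS≡s₂ m) (sym (coeff-MID≡s₂ m)))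
          , coeff-MID≡coeff-RHS
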